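{- There is a constant $C$ such that every lollipop graph $G$ with $n$ vertices satisfies $\widetilde{\mathsf{EC}}(G)\le Cn^3$ for the unweighted deterministic walk with bounded $\tilde\kappa$.
   Context: The lollipop graph on $n$ vertices consists of a clique on $n/2$ vertices and a path on the remaining $n/2$ vertices, one endpoint of the path being joined by an edge to one vertex of the clique. Unweighted deterministic walk: each vertex $u$ has a rotor sequence of length $\tilde d(u)$ of neighbours of $u$, each occurring exactly $\tilde d(u)/\deg(u)$ times, and an initial rotor position; $\tilde\kappa=\max_u\tilde d(u)/\deg(u)$; the constant $C$ may depend on an upper bound on $\tilde\kappa$. The walk moves from the current vertex to the vertex its rotor points at and then advances that rotor cyclically. $\widetilde{\mathsf{EC}}(G)$ is the maximum over start vertices and all rotor sequences/initial positions (lengths fixed) of the first time every edge has been traversed. (The paper states its bounds for specific graphs under the standing assumption $\tilde\kappa=O(1)$.) -}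

module Defs where

open import Data.Nat using (ℕ; zero; suc; _+_; _*_; _^_; _≤_; _<_; _<?_)
open import Data.Fin using (Fin; toℕ; fromℕ<; _≟_)
import Data.Fin
open import Data.List using (List; length; filter)
open import Data.List using () renaming (allFin to allFinL)
open import Data.Product using (Σ; _×_; _,_; proj₁; ∃-syntax)
open import Data.Sum using (_⊎_)
open import Relation.Nullary using (¬_; yes; no)
open import Relation.Binary.PropositionalEquality using (_≡_; _≢_; refl)

-- Vertices 0 .. m-1 form a clique; vertices m .. 2m-1 form a path
-- m — m+1 — … — 2m-1; the path endpoint m is joined to clique vertex m-1.

-- consecutive edge a — a+1 of the path (including the joining edge (m-1, m))
PathEdge : ℕ → ℕ → ℕ → Set
PathEdge m a b = (suc a ≡ b) × (m ≤ b)

CliqueEdge : ℕ → ℕ → ℕ → Set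
CliqueEdge m a b = (a < m) × (b < m) × (a ≢ b)

LollipopAdj : (m : ℕ) → Fin (m + m) → Fin (m + m) → Set
LollipopAdj m u v =
  CliqueEdge m (toℕ u) (toℕ v) ⊎ (PathEdge m (toℕ u) (toℕ v) ⊎ PathEdge m (toℕ v) (toℕ u))

-- Rotor-router (unweighted deterministic walk) configurations on Fin n.

record Rotor (n : ℕ) : Set where
  field
    len  : Fin n → ℕ
    seq  : (u : Fin n) → Fin (len u) → Fin n
    init : (u : Fin n) → Fin (len u)
open Rotor public

occ : ∀ {n} (R : Rotor n) → Fin n → Fin n → ℕ
occ R u v = length (filter (λ i → seq R u i ≟ v) (allFinL (len R u)))

-- R is a valid rotor configuration for the graph with adjacency Adj, with
-- κ̃ ≤ K: for each vertex u there is k = d̃(u)/deg(u) with 1 ≤ k ≤ K such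
-- that every neighbour of u occurs exactly k times in the sequence of u
-- and no non-neighbour occurs.
ValidRotor : ∀ {n} → (Fin n → Fin n → Set) → ℕ → Rotor n → Set
ValidRotor {n} Adj K R =
  (u : Fin n) → ∃[ k ] (1 ≤ k × k ≤ K ×
     ((v : Fin n) → (Adj u v → occ R u v ≡ k) × (¬ Adj u v → occ R u v ≡ 0)))

csuc : ∀ {k} → Fin k → Fin k
csuc {suc k} i with suc (toℕ i) <? suc k
... | yes p = fromℕ< p
... | no _  = Data.Fin.zero

State : ∀ {n} → Rotor n → Set
State {n} R = Fin n × ((u : Fin n) → Fin (len R u))

advance : ∀ {n} (R : Rotor n) → ((u : Fin n) → Fin (len R u)) → Fin n
        → (u : Fin n) → Fin (len R u)
advance R ptr x u with u ≟ x
... | yes refl = csuc (ptr x)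
... | no _     = ptr u

step : ∀ {n} (R : Rotor n) → State R → State R
step R (x , ptr) = seq R x (ptr x) , advance R ptr x

walk : ∀ {n} (R : Rotor n) → Fin n → ℕ → State R
walk R s zero    = s , init R
walk R s (suc t) = step R (walk R s t)

pos : ∀ {n} (R : Rotor n) → Fin n → ℕ → Fin n
pos R s t = proj₁ (walk R s t)

Traverses : ∀ {n} → Fin n → Fin n → Fin n → Fin n → Set
Traverses x y a b = (x ≡ a × y ≡ b) ⊎ (x ≡ b × y ≡ a)

EdgesCoveredBy : ∀ {n} → (Fin n → Fin n → Set) → Rotor n → Fin n → ℕ → Set
EdgesCoveredBy {n} Adj R s T =
  (a b : Fin n) → Adj a b →
  ∃[ t ] (suc t ≤ T × Traverses (pos R s t) (pos R s (suc t)) a b)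

module Submission where

-- Count, for the first T steps, the traversals arcs T u w of each
-- arc and the departures from each vertex.  The rotor at u advances once
-- per departure, and one full turn of it points at each neighbour κ̃(u)
-- times, so arc counts out of u differ by at most K (rotor balance, via
-- prefix sums of periodic sequences).  A path edge is a cut edge, so it is
-- crossed alternately; together with balance this makes the forward
-- crossing counts of consecutive path edges differ by at most K + 1.  If an
-- edge is never traversed, a clique vertex x (the untraversed clique arc's
-- tail, or the bridge vertex) has all out-arcs and all backward path arcs
-- used O(n·K) times; summing departures over all vertices, each compared
-- with its arc into x (hub lemma), bounds T by 6(K + 1)n³ + n²K + n.

open import Defs
open import Data.Nat using (ℕ; _+_; _*_; _^_)
open import Data.Fin using (Fin)
open import Data.Product using (∃-syntax)

open import Data.Bool using (if_then_else_)
open import Data.Nat using (zero; suc; _≤_; _<_; _∸_; z≤n; s≤s; s≤s⁻¹; _<?_; _≤?_; NonZero)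
open import Data.Nat.Properties hiding (_≟_)
open import Data.Nat.Properties using () renaming (_≟_ to _≟ℕ_)
open import Data.Nat.DivMod using (_/_; _%_; m≡m%n+[m/n]*n; m%n<n; [m+n]%n≡m%n; m<n⇒m%n≡m; n%n≡0; m%n%n≡m%n; %-distribˡ-+)
open import Data.Nat.Tactic.RingSolver using (solve-∀)
open import Data.Fin using (toℕ; fromℕ<; _≟_) renaming (zero to fzero; suc to fsuc)
open import Data.Fin.Properties using (toℕ-injective; toℕ-fromℕ<; toℕ<n)
open import Data.List using (length; filter; tabulate)
open import Data.Product using (_×_; _,_; proj₁; proj₂)
open import Data.Sum using (inj₁; inj₂)
open import Function using (_∘_)
open import Relation.Nullary using (¬_; Dec; yes; no; does; contradiction; ¬?)
open import Relation.Nullary.Decidable using (_×-dec_; _⊎-dec_)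
open import Relation.Binary.PropositionalEquality
open import Algebra.Properties.Semiring.Sum +-*-semiring using (sum; sum-cong-≗; sum-replicate-zero; ∑-distrib-+; *-distribˡ-sum)

ind : ∀ {p} {P : Set p} → Dec P → ℕ
ind d = if does d then 1 else 0

ind≤1 : ∀ {p} {P : Set p} (d : Dec P) → ind d ≤ 1
ind≤1 (yes _) = s≤s z≤n
ind≤1 (no _)  = z≤n

ind-yes : ∀ {p} {P : Set p} (d : Dec P) → P → ind d ≡ 1
ind-yes (yes _) _  = refl
ind-yes (no ¬p) p  = contradiction p ¬p

ind-no : ∀ {p} {P : Set p} (d : Dec P) → ¬ P → ind d ≡ 0
ind-no (yes p) ¬p = contradiction p ¬p
ind-no (no _)  _  = refl

ind-×-yes : ∀ {p q} {P : Set p} {Q : Set q} (d : Dec P) (x : Q) → ind (d ×-dec yes x) ≡ ind d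
ind-×-yes (yes _) _ = refl
ind-×-yes (no _)  _ = refl

sum-const : ∀ k c → sum {k} (λ _ → c) ≡ k * c
sum-const zero    c = refl
sum-const (suc k) c = cong (c +_) (sum-const k c)

sum-mono : ∀ {k} {f g : Fin k → ℕ} → (∀ i → f i ≤ g i) → sum f ≤ sum g
sum-mono {zero}  f≤g = z≤n
sum-mono {suc k} f≤g = +-mono-≤ (f≤g fzero) (sum-mono (f≤g ∘ fsuc))

term≤sum : ∀ {k} (f : Fin k → ℕ) i → f i ≤ sum f
term≤sum f fzero    = m≤m+n _ _
term≤sum f (fsuc i) = ≤-trans (term≤sum (f ∘ fsuc) i) (m≤n+m _ _)

sum-indicator : ∀ {k} (y : Fin k) → sum (λ w → ind (y ≟ w)) ≡ 1
sum-indicator {suc k} fzero    = cong suc (sum-replicate-zero k)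
sum-indicator {suc k} (fsuc y) = trans (sum-cong-≗ shift) (sum-indicator y)
  where
    shift : ∀ i → ind (fsuc y ≟ fsuc i) ≡ ind (y ≟ i)
    shift i with y ≟ i
    ... | yes _ = refl
    ... | no _  = refl

psum : ℕ → (ℕ → ℕ) → ℕ
psum zero    f = 0
psum (suc N) f = f 0 + psum N (f ∘ suc)

psum-cong : ∀ N {f g : ℕ → ℕ} → (∀ j → f j ≡ g j) → psum N f ≡ psum N g
psum-cong zero    f≡g = refl
psum-cong (suc N) f≡g = cong₂ _+_ (f≡g 0) (psum-cong N (f≡g ∘ suc))

psum-split : ∀ M N f → psum (M + N) f ≡ psum M f + psum N (λ j → f (M + j))
psum-split zero    N f = refl
psum-split (suc M) N f = trans (cong (f 0 +_) (psum-split M N (f ∘ suc))) (sym (+-assoc (f 0) _ _))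

psum-snoc : ∀ N f → psum (suc N) f ≡ psum N f + f N
psum-snoc zero    f = +-comm (f 0) 0
psum-snoc (suc N) f = trans (cong (f 0 +_) (psum-snoc N (f ∘ suc))) (sym (+-assoc (f 0) _ _))

psum-mono : ∀ {M N} f → M ≤ N → psum M f ≤ psum N f
psum-mono {M} {N} f M≤N = begin
  psum M f                               ≤⟨ m≤m+n _ _ ⟩
  psum M f + psum (N ∸ M) (λ j → f (M + j)) ≡⟨ psum-split M (N ∸ M) f ⟨
  psum (M + (N ∸ M)) f                   ≡⟨ cong (λ k → psum k f) (m+[n∸m]≡n M≤N) ⟩
  psum N f                               ∎
  where open ≤-Reasoning

psum-table : ∀ {k} (t : Fin k → ℕ) (G : ℕ → ℕ) → (∀ i → G (toℕ i) ≡ t i) → psum k G ≡ sum t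
psum-table {zero}  t G G≡t = refl
psum-table {suc k} t G G≡t = cong₂ _+_ (G≡t fzero) (psum-table (t ∘ fsuc) (G ∘ suc) (G≡t ∘ fsuc))

Periodic : ℕ → (ℕ → ℕ) → Set
Periodic L f = ∀ j → f (L + j) ≡ f j

psum-periodic : ∀ {L f} → Periodic L f → ∀ q r → psum (q * L + r) f ≡ q * psum L f + psum r f
psum-periodic         per zero    r = refl
psum-periodic {L} {f} per (suc q) r = begin
  psum (L + q * L + r) f                          ≡⟨ cong (λ k → psum k f) (+-assoc L (q * L) r) ⟩
  psum (L + (q * L + r)) f                        ≡⟨ psum-split L (q * L + r) f ⟩
  psum L f + psum (q * L + r) (λ j → f (L + j))   ≡⟨ cong (psum L f +_) (psum-cong (q * L + r) per) ⟩
  psum L f + psum (q * L + r) f                   ≡⟨ cong (psum L f +_) (psum-periodic per q r) ⟩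
  psum L f + (q * psum L f + psum r f)            ≡⟨ +-assoc (psum L f) _ _ ⟨
  psum L f + q * psum L f + psum r f              ∎
  where open ≡-Reasoning

psum-window : ∀ {L f} → Periodic L f → ∀ c → psum L (λ j → f (c + j)) ≡ psum L f
psum-window {L} {f} per c = +-cancelˡ-≡ (psum c f) _ _ (begin
  psum c f + psum L (λ j → f (c + j)) ≡⟨ psum-split c L f ⟨
  psum (c + L) f                      ≡⟨ cong (λ k → psum k f) (trans (+-comm c L) (cong (_+ c) (sym (*-identityˡ L)))) ⟩
  psum (1 * L + c) f                  ≡⟨ psum-periodic per 1 c ⟩
  1 * psum L f + psum c f             ≡⟨ trans (cong (_+ psum c f) (*-identityˡ _)) (+-comm (psum L f) _) ⟩
  psum c f + psum L f                 ∎)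
  where open ≡-Reasoning

periodic-balance : ∀ L .{{_ : NonZero L}} {g h} → Periodic L g → Periodic L h →
                   psum L g ≤ psum L h → ∀ N → psum N g ≤ psum N h + psum L g
periodic-balance L {g} {h} per-g per-h kg≤kh N = begin
  psum N g                          ≡⟨ cong (λ k → psum k g) N≡qL+r ⟩
  psum (q * L + r) g                ≡⟨ psum-periodic per-g q r ⟩
  q * psum L g + psum r g           ≤⟨ +-monoʳ-≤ (q * psum L g) (psum-mono g (<⇒≤ (m%n<n N L))) ⟩
  q * psum L g + psum L g           ≤⟨ +-monoˡ-≤ (psum L g) (*-monoʳ-≤ q kg≤kh) ⟩
  q * psum L h + psum L g           ≤⟨ +-monoˡ-≤ (psum L g) (m≤m+n (q * psum L h) (psum r h)) ⟩
  q * psum L h + psum r h + psum L g ≡⟨ cong (_+ psum L g) (psum-periodic per-h q r) ⟨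
  psum (q * L + r) h + psum L g     ≡⟨ cong (λ k → psum k h + psum L g) N≡qL+r ⟨
  psum N h + psum L g               ∎
  where
    open ≤-Reasoning
    q r : ℕ
    q = N / L
    r = N % L
    N≡qL+r : N ≡ q * L + r
    N≡qL+r = trans (m≡m%n+[m/n]*n N L) (+-comm r (q * L))

advanceBy : ∀ {L} → ℕ → Fin L → Fin L
advanceBy zero    i = i
advanceBy (suc j) i = csuc (advanceBy j i)

toℕ-csuc : ∀ {l} (i : Fin (suc l)) → toℕ (csuc i) ≡ suc (toℕ i) % suc l
toℕ-csuc {l} i with suc (toℕ i) <? suc l
... | yes i+1<L = trans (toℕ-fromℕ< i+1<L) (sym (m<n⇒m%n≡m i+1<L))
... | no  i+1≮L = sym (trans (cong (_% suc l) i+1≡L) (n%n≡0 (suc l)))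
  where
    i+1≡L : suc (toℕ i) ≡ suc l
    i+1≡L = ≤-antisym (toℕ<n i) (≮⇒≥ i+1≮L)

suc-%-% : ∀ x L .{{_ : NonZero L}} → suc (x % L) % L ≡ suc x % L
suc-%-% x L = begin
  (1 + x % L) % L              ≡⟨ %-distribˡ-+ 1 (x % L) L ⟩
  (1 % L + x % L % L) % L      ≡⟨ cong (λ y → (1 % L + y) % L) (m%n%n≡m%n x L) ⟩
  (1 % L + x % L) % L          ≡⟨ %-distribˡ-+ 1 x L ⟨
  (1 + x) % L                  ∎
  where open ≡-Reasoning

toℕ-advanceBy : ∀ {l} j (i : Fin (suc l)) → toℕ (advanceBy j i) ≡ (toℕ i + j) % suc l
toℕ-advanceBy {l} zero    i = trans (sym (m<n⇒m%n≡m (toℕ<n i))) (cong (_% suc l) (sym (+-identityʳ (toℕ i))))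
toℕ-advanceBy {l} (suc j) i = begin
  toℕ (csuc (advanceBy j i))     ≡⟨ toℕ-csuc (advanceBy j i) ⟩
  suc (toℕ (advanceBy j i)) % L  ≡⟨ cong (λ y → suc y % L) (toℕ-advanceBy j i) ⟩
  suc ((toℕ i + j) % L) % L      ≡⟨ suc-%-% (toℕ i + j) L ⟩
  suc (toℕ i + j) % L            ≡⟨ cong (_% L) (sym (+-suc (toℕ i) j)) ⟩
  (toℕ i + suc j) % L            ∎
  where
    open ≡-Reasoning
    L : ℕ
    L = suc l

-- Reading a table h at the successive positions of a rotor started at i₀
-- gives an L-periodic sequence whose period sum is the sum of the table:
-- one full turn visits every position exactly once.
module Rotation {l} (h : Fin (suc l) → ℕ) (i₀ : Fin (suc l)) where
  L : ℕ
  L = suc l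

  reading : ℕ → ℕ
  reading j = h (advanceBy j i₀)

  byResidue : ℕ → ℕ
  byResidue a = h (fromℕ< (m%n<n a L))

  reading≡byResidue : ∀ j → reading j ≡ byResidue (toℕ i₀ + j)
  reading≡byResidue j = cong h (toℕ-injective (trans (toℕ-advanceBy j i₀) (sym (toℕ-fromℕ< _))))

  byResidue-periodic : Periodic L byResidue
  byResidue-periodic a = cong h (toℕ-injective (begin
    toℕ (fromℕ< (m%n<n (L + a) L)) ≡⟨ toℕ-fromℕ< _ ⟩
    (L + a) % L                    ≡⟨ cong (_% L) (+-comm L a) ⟩
    (a + L) % L                    ≡⟨ [m+n]%n≡m%n a L ⟩
    a % L                          ≡⟨ toℕ-fromℕ< _ ⟨
    toℕ (fromℕ< (m%n<n a L))       ∎))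
    where open ≡-Reasoning

  reading-periodic : Periodic L reading
  reading-periodic j = begin
    reading (L + j)             ≡⟨ reading≡byResidue (L + j) ⟩
    byResidue (toℕ i₀ + (L + j)) ≡⟨ cong byResidue (trans (sym (+-assoc (toℕ i₀) L j))
                                      (trans (cong (_+ j) (+-comm (toℕ i₀) L)) (+-assoc L (toℕ i₀) j))) ⟩
    byResidue (L + (toℕ i₀ + j)) ≡⟨ byResidue-periodic (toℕ i₀ + j) ⟩
    byResidue (toℕ i₀ + j)       ≡⟨ reading≡byResidue j ⟨
    reading j                    ∎
    where open ≡-Reasoning

  full-turn : psum L reading ≡ sum h
  full-turn = begin
    psum L reading                       ≡⟨ psum-cong L reading≡byResidue ⟩
    psum L (λ j → byResidue (toℕ i₀ + j)) ≡⟨ psum-window byResidue-periodic (toℕ i₀) ⟩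
    psum L byResidue                     ≡⟨ psum-table h byResidue residue-of-index ⟩
    sum h                                ∎
    where
      open ≡-Reasoning
      residue-of-index : ∀ i → byResidue (toℕ i) ≡ h i
      residue-of-index i = cong h (toℕ-injective (trans (toℕ-fromℕ< _) (m<n⇒m%n≡m (toℕ<n i))))

count : ∀ {L n} → (Fin L → Fin n) → Fin n → ℕ
count sq v = sum (λ i → ind (sq i ≟ v))

rotor-balance : ∀ {L n} (sq : Fin L → Fin n) (i₀ : Fin L) {v z} → count sq v ≤ count sq z → ∀ N →
  psum N (λ j → ind (sq (advanceBy j i₀) ≟ v)) ≤ psum N (λ j → ind (sq (advanceBy j i₀) ≟ z)) + count sq v
rotor-balance {suc l} sq i₀ {v} {z} cv≤cz N =
  subst (λ c → psum N V.reading ≤ psum N Z.reading + c) V.full-turn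
    (periodic-balance (suc l) V.reading-periodic Z.reading-periodic
      (subst₂ _≤_ (sym V.full-turn) (sym Z.full-turn) cv≤cz) N)
  where
    module V = Rotation (λ i → ind (sq i ≟ v)) i₀
    module Z = Rotation (λ i → ind (sq i ≟ z)) i₀

length-filter-tabulate : ∀ {a p} {A : Set a} {P : A → Set p} (P? : ∀ x → Dec (P x)) {k} (f : Fin k → A) →
  length (filter P? (tabulate f)) ≡ sum (λ i → ind (P? (f i)))
length-filter-tabulate P? {zero}  f = refl
length-filter-tabulate P? {suc k} f with P? (f fzero)
... | yes _ = cong suc (length-filter-tabulate P? (f ∘ fsuc))
... | no _  = length-filter-tabulate P? (f ∘ fsuc)

occ≡count : ∀ {n} (R : Rotor n) u v → occ R u v ≡ count (seq R u) v
occ≡count R u v = length-filter-tabulate (λ i → seq R u i ≟ v) (λ i → i)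

occ-entry : ∀ {n} (R : Rotor n) u i → 1 ≤ occ R u (seq R u i)
occ-entry R u i = subst (1 ≤_) (sym (occ≡count R u (seq R u i)))
  (≤-trans (≤-reflexive (sym (ind-yes (seq R u i ≟ seq R u i) refl)))
           (term≤sum (λ j → ind (seq R u j ≟ seq R u i)) i))

advance-here : ∀ {n} (R : Rotor n) ptr x → advance R ptr x x ≡ csuc (ptr x)
advance-here R ptr x with x ≟ x
... | yes refl = refl
... | no x≢x   = contradiction refl x≢x

advance-elsewhere : ∀ {n} (R : Rotor n) ptr {x u} → u ≢ x → advance R ptr x u ≡ ptr u
advance-elsewhere R ptr {x} {u} u≢x with u ≟ x
... | yes u≡x = contradiction u≡x u≢x
... | no _    = refl

module Walk {n} (R : Rotor n) (s : Fin n) where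
  P : ℕ → Fin n
  P t = pos R s t

  rotors : ℕ → (u : Fin n) → Fin (len R u)
  rotors t = proj₂ (walk R s t)

  departures : ℕ → Fin n → ℕ
  departures zero    u = 0
  departures (suc t) u = ind (P t ≟ u) + departures t u

  arrivals : ℕ → Fin n → ℕ
  arrivals zero    u = 0
  arrivals (suc t) u = ind (P (suc t) ≟ u) + arrivals t u

  arcs : ℕ → Fin n → Fin n → ℕ
  arcs zero    u w = 0
  arcs (suc t) u w = ind ((P t ≟ u) ×-dec (P (suc t) ≟ w)) + arcs t u w

  rotor-position : ∀ t u → rotors t u ≡ advanceBy (departures t u) (init R u)
  rotor-position zero    u = refl
  rotor-position (suc t) u with P t ≟ u
  ... | yes refl = trans (advance-here R (rotors t) (P t)) (cong csuc (rotor-position t (P t)))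
  ... | no Pt≢u  = trans (advance-elsewhere R (rotors t) (Pt≢u ∘ sym)) (rotor-position t u)

  points-at : Fin n → Fin n → ℕ → ℕ
  points-at u w j = ind (seq R u (advanceBy j (init R u)) ≟ w)

  arcs≡psum : ∀ t u w → arcs t u w ≡ psum (departures t u) (points-at u w)
  arcs≡psum zero    u w = refl
  arcs≡psum (suc t) u w with P t ≟ u
  ... | no _     = arcs≡psum t u w
  ... | yes refl = trans (cong₂ _+_ (cong (λ i → ind (seq R (P t) i ≟ w)) (rotor-position t (P t))) (arcs≡psum t (P t) w))
                         (trans (+-comm (points-at (P t) w (departures t (P t))) _) (sym (psum-snoc (departures t (P t)) (points-at (P t) w))))

  arc-balance : ∀ t u {w z} → occ R u w ≤ occ R u z → arcs t u w ≤ arcs t u z + occ R u w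
  arc-balance t u {w} {z} ow≤oz
    rewrite arcs≡psum t u w | arcs≡psum t u z | occ≡count R u w | occ≡count R u z
    = rotor-balance (seq R u) (init R u) ow≤oz (departures t u)

  departures≡sum-arcs : ∀ t u → sum (arcs t u) ≡ departures t u
  departures≡sum-arcs zero    u = sum-replicate-zero n
  departures≡sum-arcs (suc t) u = trans (∑-distrib-+ (λ w → ind ((P t ≟ u) ×-dec (P (suc t) ≟ w))) (arcs t u))
    (cong₂ _+_ last-step (departures≡sum-arcs t u))
    where
      last-step : sum (λ w → ind ((P t ≟ u) ×-dec (P (suc t) ≟ w))) ≡ ind (P t ≟ u)
      last-step with P t ≟ u
      ... | yes _ = sum-indicator (P (suc t))
      ... | no _  = sum-replicate-zero n

  arrivals≡sum-arcs : ∀ t w → sum (λ u → arcs t u w) ≡ arrivals t w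
  arrivals≡sum-arcs zero    w = sum-replicate-zero n
  arrivals≡sum-arcs (suc t) w = trans (∑-distrib-+ (λ u → ind ((P t ≟ u) ×-dec (P (suc t) ≟ w))) (λ u → arcs t u w))
    (cong₂ _+_ last-step (arrivals≡sum-arcs t w))
    where
      last-step : sum (λ u → ind ((P t ≟ u) ×-dec (P (suc t) ≟ w))) ≡ ind (P (suc t) ≟ w)
      last-step with P (suc t) ≟ w
      ... | yes Pt+1≡w = trans (sum-cong-≗ (λ u → ind-×-yes (P t ≟ u) Pt+1≡w)) (sum-indicator (P t))
      ... | no Pt+1≢w = trans (sum-cong-≗ (λ u → ind-no ((P t ≟ u) ×-dec no Pt+1≢w) (Pt+1≢w ∘ proj₂))) (sum-replicate-zero n)

  -- Every step departs from exactly one vertex.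
  sum-departures : ∀ t → sum (departures t) ≡ t
  sum-departures zero    = sum-replicate-zero n
  sum-departures (suc t) = trans (∑-distrib-+ (λ u → ind (P t ≟ u)) (departures t))
                                 (cong₂ _+_ (sum-indicator (P t)) (sum-departures t))

  -- Flow conservation: every arrival at u except the current visit is
  -- followed by a departure, and the start counts as an arrival.
  flow : ∀ t u → arrivals t u + ind (P 0 ≟ u) ≡ departures t u + ind (P t ≟ u)
  flow zero    u = refl
  flow (suc t) u = begin
    a′ + arrivals t u + ind (P 0 ≟ u)   ≡⟨ +-assoc a′ _ _ ⟩
    a′ + (arrivals t u + ind (P 0 ≟ u)) ≡⟨ cong (a′ +_) (flow t u) ⟩
    a′ + (departures t u + d′)          ≡⟨ +-comm a′ _ ⟩
    departures t u + d′ + a′            ≡⟨ cong (_+ a′) (+-comm (departures t u) d′) ⟩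
    d′ + departures t u + a′            ∎
    where
      open ≡-Reasoning
      a′ d′ : ℕ
      a′ = ind (P (suc t) ≟ u)
      d′ = ind (P t ≟ u)

  arrivals≤departures+1 : ∀ t u → arrivals t u ≤ departures t u + 1
  arrivals≤departures+1 t u = begin
    arrivals t u                   ≤⟨ m≤m+n _ _ ⟩
    arrivals t u + ind (P 0 ≟ u)   ≡⟨ flow t u ⟩
    departures t u + ind (P t ≟ u) ≤⟨ +-monoʳ-≤ (departures t u) (ind≤1 (P t ≟ u)) ⟩
    departures t u + 1             ∎
    where open ≤-Reasoning

  arc-into-bound : ∀ t v u → arcs t v u ≤ departures t u + 1
  arc-into-bound t v u = begin
    arcs t v u                ≤⟨ term≤sum (λ v′ → arcs t v′ u) v ⟩
    sum (λ v′ → arcs t v′ u)  ≡⟨ arrivals≡sum-arcs t u ⟩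
    arrivals t u              ≤⟨ arrivals≤departures+1 t u ⟩
    departures t u + 1        ∎
    where open ≤-Reasoning

  departures-below : ∀ t u {b} → (∀ w → arcs t u w ≤ b) → departures t u ≤ n * b
  departures-below t u {b} arcs≤b = begin
    departures t u      ≡⟨ departures≡sum-arcs t u ⟨
    sum (arcs t u)      ≤⟨ sum-mono arcs≤b ⟩
    sum {n} (λ _ → b)   ≡⟨ sum-const n b ⟩
    n * b               ∎
    where open ≤-Reasoning

  arc-witness : ∀ t {u w} → 0 < arcs t u w → ∃[ t′ ] (suc t′ ≤ t × P t′ ≡ u × P (suc t′) ≡ w)
  arc-witness (suc t) {u} {w} used = at-last-step ((P t ≟ u) ×-dec (P (suc t) ≟ w)) used
    where
      at-last-step : (d : Dec (P t ≡ u × P (suc t) ≡ w)) → 0 < ind d + arcs t u w →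
                     ∃[ t′ ] (suc t′ ≤ suc t × P t′ ≡ u × P (suc t′) ≡ w)
      at-last-step (yes (Pt≡u , Pt+1≡w)) _ = t , ≤-refl , Pt≡u , Pt+1≡w
      at-last-step (no _) used-before with arc-witness t used-before
      ... | t′ , t′<t , at-u , at-w = t′ , m≤n⇒m≤1+n t′<t , at-u , at-w

module ValidWalk {n} (Adj : Fin n → Fin n → Set) (adj? : ∀ u v → Dec (Adj u v))
                 (adj-sym : ∀ {u v} → Adj u v → Adj v u)
                 (K : ℕ) (R : Rotor n) (valid : ValidRotor Adj K R) (s : Fin n) where
  open Walk R s public

  occ≤K : ∀ u w → occ R u w ≤ K
  occ≤K u w with valid u | adj? u w
  ... | _ , _ , k≤K , occs | yes uw = ≤-trans (≤-reflexive (proj₁ (occs w) uw)) k≤K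
  ... | _ , _ , k≤K , occs | no ¬uw = ≤-trans (≤-reflexive (proj₂ (occs w) ¬uw)) z≤n

  occ-neighbour : ∀ u {w z} → Adj u z → occ R u w ≤ occ R u z
  occ-neighbour u {w} {z} uz with valid u | adj? u w
  ... | _ , _ , _ , occs | yes uw = ≤-reflexive (trans (proj₁ (occs w) uw) (sym (proj₁ (occs z) uz)))
  ... | _ , _ , _ , occs | no ¬uw = subst (_≤ occ R u z) (sym (proj₂ (occs w) ¬uw)) z≤n

  arc-balance-K : ∀ t u w {z} → Adj u z → arcs t u w ≤ arcs t u z + K
  arc-balance-K t u w uz = ≤-trans (arc-balance t u (occ-neighbour u uz)) (+-monoʳ-≤ _ (occ≤K u w))

  departures-bound : ∀ t u {z} → Adj u z → departures t u ≤ n * (arcs t u z + K)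
  departures-bound t u uz = departures-below t u (λ w → arc-balance-K t u w uz)

  -- The walk moves along edges: its next vertex occurs in the rotor sequence.
  moves-along-edges : ∀ t → Adj (P t) (P (suc t))
  moves-along-edges t with adj? (P t) (P (suc t))
  ... | yes edge = edge
  ... | no ¬edge with valid (P t)
  ...   | _ , _ , _ , occs = contradiction (proj₂ (occs (P (suc t))) ¬edge)
                               (≢-sym (<⇒≢ (occ-entry R (P t) (rotors t (P t)))))

  -- Cut lemma: if {a, b} is the only edge between a vertex set S ∋ b and
  -- its complement ∌ a, then the walk crosses a → b and b → a alternately,
  -- so the two counts differ by whether the start and current vertex lie in S.
  module Cut {S : Fin n → Set} (S? : ∀ v → Dec (S v)) {a b : Fin n} (a∉S : ¬ S a) (b∈S : S b)
             (only-edge : ∀ {x y} → Adj x y → ¬ S x → S y → x ≡ a × y ≡ b) where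

    crossing : ∀ {x y} → Adj x y →
      ind ((x ≟ a) ×-dec (y ≟ b)) + ind (S? x) ≡ ind ((x ≟ b) ×-dec (y ≟ a)) + ind (S? y)
    crossing {x} {y} xy with S? x | S? y
    ... | yes x∈S | yes y∈S = cong (_+ 1) (trans (ind-no ((x ≟ a) ×-dec (y ≟ b)) λ (x≡a , _) → a∉S (subst S x≡a x∈S))
                                          (sym (ind-no ((x ≟ b) ×-dec (y ≟ a)) λ (_ , y≡a) → a∉S (subst S y≡a y∈S))))
    ... | no x∉S  | no y∉S  = cong (_+ 0) (trans (ind-no ((x ≟ a) ×-dec (y ≟ b)) λ (_ , y≡b) → y∉S (subst S (sym y≡b) b∈S))
                                          (sym (ind-no ((x ≟ b) ×-dec (y ≟ a)) λ (x≡b , _) → x∉S (subst S (sym x≡b) b∈S))))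
    ... | no x∉S  | yes y∈S = let (x≡a , y≡b) = only-edge xy x∉S y∈S in
      trans (cong (_+ 0) (ind-yes ((x ≟ a) ×-dec (y ≟ b)) (x≡a , y≡b)))
            (sym (cong (_+ 1) (ind-no ((x ≟ b) ×-dec (y ≟ a)) λ (x≡b , _) → x∉S (subst S (sym x≡b) b∈S))))
    ... | yes x∈S | no y∉S  = let (y≡a , x≡b) = only-edge (adj-sym xy) y∉S x∈S in
      trans (cong (_+ 1) (ind-no ((x ≟ a) ×-dec (y ≟ b)) λ (_ , y≡b) → y∉S (subst S (sym y≡b) b∈S)))
            (sym (cong (_+ 0) (ind-yes ((x ≟ b) ×-dec (y ≟ a)) (x≡b , y≡a))))

    cut-invariant : ∀ t → arcs t a b + ind (S? (P 0)) ≡ arcs t b a + ind (S? (P t))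
    cut-invariant zero    = refl
    cut-invariant (suc t) = begin
      ab′ + arcs t a b + ind (S? (P 0))        ≡⟨ +-assoc ab′ _ _ ⟩
      ab′ + (arcs t a b + ind (S? (P 0)))      ≡⟨ cong (ab′ +_) (cut-invariant t) ⟩
      ab′ + (arcs t b a + ind (S? (P t)))      ≡⟨ rearrange ab′ (arcs t b a) _ ⟩
      arcs t b a + (ab′ + ind (S? (P t)))      ≡⟨ cong (arcs t b a +_) (crossing (moves-along-edges t)) ⟩
      arcs t b a + (ba′ + ind (S? (P (suc t)))) ≡⟨ rearrange (arcs t b a) ba′ _ ⟩
      ba′ + (arcs t b a + ind (S? (P (suc t)))) ≡⟨ +-assoc ba′ _ _ ⟨
      ba′ + arcs t b a + ind (S? (P (suc t)))  ∎
      where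
        open ≡-Reasoning
        ab′ ba′ : ℕ
        ab′ = ind ((P t ≟ a) ×-dec (P (suc t) ≟ b))
        ba′ = ind ((P t ≟ b) ×-dec (P (suc t) ≟ a))
        rearrange : ∀ x y z → x + (y + z) ≡ y + (x + z)
        rearrange = solve-∀

    cut-forward : ∀ t → arcs t a b ≤ arcs t b a + 1
    cut-forward t = ≤-trans (m≤m+n _ _) (≤-trans (≤-reflexive (cut-invariant t)) (+-monoʳ-≤ _ (ind≤1 (S? (P t)))))

    cut-backward : ∀ t → arcs t b a ≤ arcs t a b + 1
    cut-backward t = ≤-trans (m≤m+n _ _) (≤-trans (≤-reflexive (sym (cut-invariant t))) (+-monoʳ-≤ _ (ind≤1 (S? (P 0)))))

-- A sequence whose consecutive terms below N differ by at most c varies by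
-- at most (i + j)·c between indices i, j < N (compare both with h 0).
spread : ∀ (h : ℕ → ℕ) c N → (∀ k → suc k < N → h (suc k) ≤ h k + c × h k ≤ h (suc k) + c) →
         ∀ i j → i < N → j < N → h i ≤ h j + (i + j) * c
spread h c N steps i j i<N j<N = begin
  h i                  ≤⟨ from-zero i i<N ⟩
  h 0 + i * c          ≤⟨ +-monoˡ-≤ (i * c) (to-zero j j<N) ⟩
  h j + j * c + i * c  ≡⟨ regroup (h j) i j c ⟩
  h j + (i + j) * c    ∎
  where
    open ≤-Reasoning
    regroup : ∀ x i j c → x + j * c + i * c ≡ x + (i + j) * c
    regroup = solve-∀
    from-zero : ∀ i → i < N → h i ≤ h 0 + i * c
    from-zero zero    _     = m≤m+n (h 0) 0
    from-zero (suc i) i+1<N = begin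
      h (suc i)         ≤⟨ proj₁ (steps i i+1<N) ⟩
      h i + c           ≤⟨ +-monoˡ-≤ c (from-zero i (<-trans (n<1+n i) i+1<N)) ⟩
      h 0 + i * c + c   ≡⟨ trans (+-assoc (h 0) _ c) (cong (h 0 +_) (+-comm (i * c) c)) ⟩
      h 0 + suc i * c   ∎
    to-zero : ∀ i → i < N → h 0 ≤ h i + i * c
    to-zero zero    _     = m≤m+n (h 0) 0
    to-zero (suc i) i+1<N = begin
      h 0                    ≤⟨ to-zero i (<-trans (n<1+n i) i+1<N) ⟩
      h i + i * c            ≤⟨ +-monoˡ-≤ (i * c) (proj₂ (steps i i+1<N)) ⟩
      h (suc i) + c + i * c  ≡⟨ +-assoc (h (suc i)) c _ ⟩
      h (suc i) + suc i * c  ∎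

-- The lollipop graph with clique {0, …, m′} and path m′ — m — … — 2m − 1,
-- where m = m′ + 1 and n = 2m.  The k-th path edge (k < m) joins the
-- vertices k + m′ and k + m; edge 0 is the bridge into the clique.
module Lollipop (m′ K : ℕ) where
  m n : ℕ
  m = suc m′
  n = m + m

  Adj : Fin n → Fin n → Set
  Adj = LollipopAdj m

  adj? : ∀ u v → Dec (Adj u v)
  adj? u v = clique? ⊎-dec (path? (toℕ u) (toℕ v) ⊎-dec path? (toℕ v) (toℕ u))
    where
      clique? : Dec (CliqueEdge m (toℕ u) (toℕ v))
      clique? = (toℕ u <? m) ×-dec (toℕ v <? m) ×-dec ¬? (toℕ u ≟ℕ toℕ v)
      path? : ∀ a b → Dec (PathEdge m a b)
      path? a b = (suc a ≟ℕ b) ×-dec (m ≤? b)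

  adj-sym : ∀ {u v} → Adj u v → Adj v u
  adj-sym (inj₁ (u<m , v<m , u≢v)) = inj₁ (v<m , u<m , ≢-sym u≢v)
  adj-sym (inj₂ (inj₁ uv))         = inj₂ (inj₂ uv)
  adj-sym (inj₂ (inj₂ vu))         = inj₂ (inj₁ vu)

  -- the vertex with a given number
  vertex : ℕ → Fin n
  vertex i with i <? n
  ... | yes i<n = fromℕ< i<n
  ... | no _    = fzero

  toℕ-vertex : ∀ {i} → i < n → toℕ (vertex i) ≡ i
  toℕ-vertex {i} i<n with i <? n
  ... | yes _   = toℕ-fromℕ< i<n
  ... | no i≮n  = contradiction i<n i≮n

  vertex-≡ : ∀ {v i} → toℕ v ≡ i → v ≡ vertex i
  vertex-≡ {v} refl = toℕ-injective (sym (toℕ-vertex (toℕ<n v)))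

  path-end<n : ∀ {k} → k < m → k + m < n
  path-end<n {k} k<m = +-monoˡ-< m k<m

  path-start<n : ∀ {k} → k < m → k + m′ < n
  path-start<n {k} k<m = <-trans (+-monoʳ-< k (n<1+n m′)) (path-end<n k<m)

  toℕ-path-end : ∀ {k} → k < m → toℕ (vertex (k + m)) ≡ suc (k + m′)
  toℕ-path-end {k} k<m = trans (toℕ-vertex (path-end<n k<m)) (+-suc k m′)

  clique-adj : ∀ {u v} → toℕ u < m → toℕ v < m → u ≢ v → Adj u v
  clique-adj u<m v<m u≢v = inj₁ (u<m , v<m , u≢v ∘ toℕ-injective)

  path-adj : ∀ {k} → k < m → Adj (vertex (k + m′)) (vertex (k + m))
  path-adj {k} k<m = inj₂ (inj₁ (trans (cong suc (toℕ-vertex (path-start<n k<m))) (sym (toℕ-path-end k<m))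
                               , subst (m ≤_) (sym (toℕ-vertex (path-end<n k<m))) (m≤n+m m k)))

  path-index : ∀ {i} → m ≤ i → i < n → ∃[ k ] (k < m × i ≡ k + m)
  path-index {i} m≤i i<n = i ∸ m , +-cancelʳ-< m (i ∸ m) m (subst (_< n) i≡k+m i<n) , i≡k+m
    where
      i≡k+m : i ≡ i ∸ m + m
      i≡k+m = sym (m∸n+n≡m m≤i)

  path-vertex-index : ∀ {w} → m ≤ toℕ w → ∃[ k ] (k < m × w ≡ vertex (k + m))
  path-vertex-index {w} m≤w with path-index m≤w (toℕ<n w)
  ... | k , k<m , w≡k+m = k , k<m , vertex-≡ w≡k+m

  path-edge-index : ∀ {u v} → PathEdge m (toℕ u) (toℕ v) → ∃[ k ] (k < m × u ≡ vertex (k + m′) × v ≡ vertex (k + m))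
  path-edge-index {u} {v} (u+1≡v , m≤v) with path-index m≤v (toℕ<n v)
  ... | k , k<m , v≡k+m = k , k<m , vertex-≡ (suc-injective (trans u+1≡v (trans v≡k+m (+-suc k m′)))) , vertex-≡ v≡k+m

  path-crossing : ∀ {a} → m′ ≤ a → ∀ {x y} → Adj x y → toℕ x ≤ a → a < toℕ y → toℕ x ≡ a × toℕ y ≡ suc a
  path-crossing m′≤a (inj₁ (_ , y<m , _)) _ a<y = contradiction (≤-trans y<m (≤-trans (s≤s m′≤a) a<y)) (<-irrefl refl)
  path-crossing {a} m′≤a {x} (inj₂ (inj₁ (x+1≡y , _))) x≤a a<y = x≡a , trans (sym x+1≡y) (cong suc x≡a)
    where
      x≡a : toℕ x ≡ a
      x≡a = ≤-antisym x≤a (s≤s⁻¹ (subst (_ <_) (sym x+1≡y) a<y))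
  path-crossing {a} m′≤a (inj₂ (inj₂ (y+1≡x , _))) x≤a a<y =
    contradiction (≤-trans (≤-trans (≤-reflexive y+1≡x) x≤a) (≤-trans (n≤1+n a) a<y)) (<-irrefl refl)

  -- Q = n(K + 1) bounds the variation of the forward crossing counts
  -- along the path; the final estimate uses the hub lemma with B = 3Q.
  Q : ℕ
  Q = n * suc K

  bound : ℕ → ℕ
  bound B = n * (n * B + 1) + n * (n * (B + K))

  K+2≤Q : K + 2 ≤ Q
  K+2≤Q = subst (K + 2 ≤_) (sym (expand m′ K)) (m≤m+n (K + 2) _)
    where
      expand : ∀ μ κ → (suc μ + suc μ) * suc κ ≡ κ + 2 + (κ + (μ + μ) * suc κ)
      expand = solve-∀

  K≤Q : K ≤ Q
  K≤Q = ≤-trans (m≤m+n K 2) K+2≤Q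

  1≤Q : 1 ≤ Q
  1≤Q = ≤-trans (s≤s z≤n) (≤-trans (m≤n+m 2 K) K+2≤Q)

  nK≤Q : n * K ≤ Q
  nK≤Q = *-monoʳ-≤ n (n≤1+n K)

  within-3Q : ∀ {a b c} → a ≤ Q → b ≤ Q → c ≤ Q → a + b + c ≤ 3 * Q
  within-3Q a≤Q b≤Q c≤Q = ≤-trans (+-mono-≤ (+-mono-≤ a≤Q b≤Q) c≤Q) (≤-reflexive (thrice Q))
    where
      thrice : ∀ q → q + q + q ≡ 3 * q
      thrice = solve-∀

  module OnWalk (R : Rotor n) (valid : ValidRotor Adj K R) (s : Fin n) where
    open ValidWalk Adj adj? adj-sym K R valid s public

    forward backward : ℕ → ℕ → ℕ
    forward  t k = arcs t (vertex (k + m′)) (vertex (k + m))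
    backward t k = arcs t (vertex (k + m)) (vertex (k + m′))

    -- Each path edge is a cut edge, so it is crossed alternately.
    path-edge-balance : ∀ t {k} → k < m → forward t k ≤ backward t k + 1 × backward t k ≤ forward t k + 1
    path-edge-balance t {k} k<m = cut-forward t , cut-backward t
      where
        toℕ-start : toℕ (vertex (k + m′)) ≡ k + m′
        toℕ-start = toℕ-vertex (path-start<n k<m)
        a∉S : ¬ (k + m′ < toℕ (vertex (k + m′)))
        a∉S = <-irrefl (sym toℕ-start)
        b∈S : k + m′ < toℕ (vertex (k + m))
        b∈S = ≤-reflexive (sym (toℕ-path-end k<m))
        only-edge : ∀ {x y} → Adj x y → ¬ (k + m′ < toℕ x) → k + m′ < toℕ y →
                    x ≡ vertex (k + m′) × y ≡ vertex (k + m)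
        only-edge xy x∉S y∈S with path-crossing (m≤n+m m′ k) xy (≮⇒≥ x∉S) y∈S
        ... | x≡a , y≡a+1 = vertex-≡ x≡a , vertex-≡ (trans y≡a+1 (sym (+-suc k m′)))
        open Cut (λ v → k + m′ <? toℕ v) a∉S b∈S only-edge

    -- Consecutive path edges are crossed forward equally often up to K + 1:
    -- both are compared with the backward crossings of the earlier one,
    -- via the cut lemma and the rotor balance at their common vertex.
    path-steps : ∀ t k → suc k < m → forward t (suc k) ≤ forward t k + suc K × forward t k ≤ forward t (suc k) + suc K
    path-steps t k k+1<m = later≤earlier , earlier≤later
      where
        k<m : k < m
        k<m = <-trans (n<1+n k) k+1<m
        joint : vertex (suc k + m′) ≡ vertex (k + m)
        joint = cong vertex (sym (+-suc k m′))
        next-edge : Adj (vertex (k + m)) (vertex (suc k + m))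
        next-edge = subst (λ v → Adj v (vertex (suc k + m))) joint (path-adj k+1<m)
        forward-next : forward t (suc k) ≡ arcs t (vertex (k + m)) (vertex (suc k + m))
        forward-next = cong (λ v → arcs t v (vertex (suc k + m))) joint
        later≤earlier : forward t (suc k) ≤ forward t k + suc K
        later≤earlier = begin
          forward t (suc k)                                 ≡⟨ forward-next ⟩
          arcs t (vertex (k + m)) (vertex (suc k + m))      ≤⟨ arc-balance-K t _ _ (adj-sym (path-adj k<m)) ⟩
          backward t k + K                                  ≤⟨ +-monoˡ-≤ K (proj₂ (path-edge-balance t k<m)) ⟩
          forward t k + 1 + K                               ≡⟨ +-assoc (forward t k) 1 K ⟩
          forward t k + suc K                               ∎
          where open ≤-Reasoning
        earlier≤later : forward t k ≤ forward t (suc k) + suc K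
        earlier≤later = begin
          forward t k                                       ≤⟨ proj₁ (path-edge-balance t k<m) ⟩
          backward t k + 1                                  ≤⟨ +-monoˡ-≤ 1 (arc-balance-K t _ _ next-edge) ⟩
          arcs t (vertex (k + m)) (vertex (suc k + m)) + K + 1 ≡⟨ cong (λ x → x + K + 1) forward-next ⟨
          forward t (suc k) + K + 1                         ≡⟨ trans (+-assoc (forward t (suc k)) K 1) (cong (forward t (suc k) +_) (+-comm K 1)) ⟩
          forward t (suc k) + suc K                         ∎
          where open ≤-Reasoning

    path-spread : ∀ t {i j} → i < m → j < m → forward t i ≤ forward t j + Q
    path-spread t {i} {j} i<m j<m =
      ≤-trans (spread (forward t) (suc K) m (path-steps t) i j i<m j<m)
              (+-monoʳ-≤ (forward t j) (*-monoˡ-≤ (suc K) (<⇒≤ (+-mono-< i<m j<m))))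

    -- Every clique vertex w ≠ x is left at most
    -- n·(arcs w x + K) times, x and path vertices at most n·(B + K) times,
    -- and the arcs into x sum to at most n·B + 1.
    hub-bound : ∀ T x {B} → toℕ x < m → (∀ z → arcs T x z ≤ B) → (∀ k → k < m → backward T k ≤ B) → T ≤ bound B
    hub-bound T x {B} x<m out-of-x backward≤B = begin
      T                                                   ≡⟨ sum-departures T ⟨
      sum (departures T)                                  ≤⟨ sum-mono departures-via-x ⟩
      sum (λ w → n * arcs T w x + n * (B + K))            ≡⟨ ∑-distrib-+ (λ w → n * arcs T w x) (λ _ → n * (B + K)) ⟩
      sum (λ w → n * arcs T w x) + sum {n} (λ _ → n * (B + K))
                                                          ≡⟨ cong₂ _+_ (sym (*-distribˡ-sum n (λ w → arcs T w x))) (sum-const n _) ⟩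
      n * sum (λ w → arcs T w x) + n * (n * (B + K))      ≤⟨ +-monoˡ-≤ _ (*-monoʳ-≤ n into-x) ⟩
      bound B                                             ∎
      where
        open ≤-Reasoning
        into-x : sum (λ w → arcs T w x) ≤ n * B + 1
        into-x = begin
          sum (λ w → arcs T w x) ≡⟨ arrivals≡sum-arcs T x ⟩
          arrivals T x           ≤⟨ arrivals≤departures+1 T x ⟩
          departures T x + 1     ≤⟨ +-monoˡ-≤ 1 (departures-below T x out-of-x) ⟩
          n * B + 1              ∎
        ≤-weaken : ∀ {w} → departures T w ≤ n * (B + K) → departures T w ≤ n * arcs T w x + n * (B + K)
        ≤-weaken {w} le = ≤-trans le (m≤n+m _ (n * arcs T w x))
        departures-via-x : ∀ w → departures T w ≤ n * arcs T w x + n * (B + K)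
        departures-via-x w with toℕ w <? m
        ... | no w≮m with path-vertex-index (≮⇒≥ w≮m)
        ...   | k , k<m , refl = ≤-weaken (≤-trans (departures-bound T _ (adj-sym (path-adj k<m)))
                                                    (*-monoʳ-≤ n (+-monoˡ-≤ K (backward≤B k k<m))))
        departures-via-x w | yes w<m with w ≟ x
        ...   | yes refl = ≤-weaken (≤-trans (departures-below T x out-of-x) (*-monoʳ-≤ n (m≤m+n B K)))
        ...   | no w≢x   = begin
          departures T w                  ≤⟨ departures-bound T w (clique-adj w<m x<m w≢x) ⟩
          n * (arcs T w x + K)            ≡⟨ *-distribˡ-+ n (arcs T w x) K ⟩
          n * arcs T w x + n * K          ≤⟨ +-monoʳ-≤ (n * arcs T w x) (*-monoʳ-≤ n (m≤n+m K B)) ⟩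
          n * arcs T w x + n * (B + K)    ∎

    junction<m : toℕ (vertex m′) < m
    junction<m = subst (_< m) (sym (toℕ-vertex (path-start<n {0} (s≤s z≤n)))) (n<1+n m′)

    -- Case 1: some path edge k was never crossed forward.  Then no path edge
    -- was crossed forward more than Q times, and the junction vertex is the hub.
    uncrossed-path-edge : ∀ T {k} → k < m → forward T k ≡ 0 → T ≤ bound (3 * Q)
    uncrossed-path-edge T {k} k<m unused = hub-bound T (vertex m′) junction<m out-of-junction backward-small
      where
        forward-small : ∀ {j} → j < m → forward T j ≤ Q
        forward-small j<m = ≤-trans (path-spread T j<m k<m) (≤-reflexive (cong (_+ Q) unused))
        out-of-junction : ∀ z → arcs T (vertex m′) z ≤ 3 * Q
        out-of-junction z = begin
          arcs T (vertex m′) z ≤⟨ arc-balance-K T _ z (path-adj {0} (s≤s z≤n)) ⟩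
          forward T 0 + K      ≡⟨ +-identityʳ _ ⟨
          forward T 0 + K + 0  ≤⟨ within-3Q (forward-small (s≤s z≤n)) K≤Q z≤n ⟩
          3 * Q                ∎
          where open ≤-Reasoning
        backward-small : ∀ j → j < m → backward T j ≤ 3 * Q
        backward-small j j<m = begin
          backward T j         ≤⟨ proj₂ (path-edge-balance T j<m) ⟩
          forward T j + 1      ≡⟨ +-identityʳ _ ⟨
          forward T j + 1 + 0  ≤⟨ within-3Q (forward-small j<m) 1≤Q z≤n ⟩
          3 * Q                ∎
          where open ≤-Reasoning

    -- Then every arc out of a
    -- was used at most K times, hence the bridge at most nK + 1 + K times,
    -- and a is the hub.
    unused-clique-arc : ∀ T {a b} → toℕ a < m → toℕ b < m → a ≢ b → arcs T a b ≡ 0 → T ≤ bound (3 * Q)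
    unused-clique-arc T {a} {b} a<m b<m a≢b unused =
      hub-bound T a a<m (λ z → ≤-trans (out-of-a z) (≤-trans K≤Q (m≤m+n Q _))) backward-small
      where
        out-of-a : ∀ z → arcs T a z ≤ K
        out-of-a z = subst (λ c → arcs T a z ≤ c + K) unused (arc-balance-K T a z (clique-adj a<m b<m a≢b))
        bridge : forward T 0 ≤ n * K + 1 + K
        bridge with vertex m′ ≟ a
        ... | yes refl = ≤-trans (out-of-a (vertex m)) (m≤n+m K _)
        ... | no c≢a   = begin
          forward T 0               ≤⟨ arc-balance-K T _ _ (clique-adj junction<m a<m c≢a) ⟩
          arcs T (vertex m′) a + K  ≤⟨ +-monoˡ-≤ K (arc-into-bound T _ a) ⟩
          departures T a + 1 + K    ≤⟨ +-monoˡ-≤ K (+-monoˡ-≤ 1 (departures-below T a out-of-a)) ⟩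
          n * K + 1 + K             ∎
          where open ≤-Reasoning
        backward-small : ∀ j → j < m → backward T j ≤ 3 * Q
        backward-small j j<m = begin
          backward T j                 ≤⟨ proj₂ (path-edge-balance T j<m) ⟩
          forward T j + 1              ≤⟨ +-monoˡ-≤ 1 (path-spread T j<m (s≤s z≤n)) ⟩
          forward T 0 + Q + 1          ≤⟨ +-monoˡ-≤ 1 (+-monoˡ-≤ Q bridge) ⟩
          n * K + 1 + K + Q + 1        ≡⟨ regroup (n * K) K Q ⟩
          n * K + Q + (K + 2)          ≤⟨ within-3Q nK≤Q ≤-refl K+2≤Q ⟩
          3 * Q                        ∎
          where
            open ≤-Reasoning
            regroup : ∀ x κ q → x + 1 + κ + q + 1 ≡ x + q + (κ + 2)
            regroup = solve-∀

    unused-edge : ∀ T {a b} → Adj a b → arcs T a b ≡ 0 → arcs T b a ≡ 0 → T ≤ bound (3 * Q)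
    unused-edge T (inj₁ (a<m , b<m , a≢b)) unused-ab _ = unused-clique-arc T a<m b<m (a≢b ∘ cong toℕ) unused-ab
    unused-edge T (inj₂ (inj₁ ab)) unused-ab _ with path-edge-index ab
    ... | k , k<m , refl , refl = uncrossed-path-edge T k<m unused-ab
    unused-edge T (inj₂ (inj₂ ba)) _ unused-ba with path-edge-index ba
    ... | k , k<m , refl , refl = uncrossed-path-edge T k<m unused-ba

    edges-covered : ∀ T → bound (3 * Q) < T → EdgesCoveredBy Adj R s T
    edges-covered T long a b ab with 0 <? arcs T a b | 0 <? arcs T b a
    ... | yes used | _ with arc-witness T used
    ...   | t , t<T , at-a , at-b = t , t<T , inj₁ (at-a , at-b)
    edges-covered T long a b ab | no _ | yes used with arc-witness T used
    ...   | t , t<T , at-b , at-a = t , t<T , inj₂ (at-b , at-a)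
    edges-covered T long a b ab | no unused-ab | no unused-ba =
      contradiction (unused-edge T ab (never unused-ab) (never unused-ba)) (<⇒≱ long)
      where
        never : ∀ {x} → ¬ 0 < x → x ≡ 0
        never = n≤0⇒n≡0 ∘ ≮⇒≥

  bound<cubic : bound (3 * Q) < 12 * suc K * n ^ 3
  bound<cubic = subst (bound (3 * Q) <_) (sym (expand (m′ + suc m′) K)) (m≤m+n (suc (bound (3 * Q))) _)
    where
      expand : ∀ k κ → 12 * (1 + κ) * ((1 + k) * ((1 + k) * ((1 + k) * 1))) ≡
        1 + ((1 + k) * ((1 + k) * (3 * ((1 + k) * (1 + κ))) + 1) + (1 + k) * ((1 + k) * (3 * ((1 + k) * (1 + κ)) + κ)))
        + ((1 + k) * (1 + k) * κ * (6 * k + 5) + 6 * (k * k * k) + 18 * (k * k) + 17 * k + 4)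
      expand = solve-∀

theorem3p18 : (K : ℕ) → ∃[ C ] ((m : ℕ) (R : Rotor (m + m)) → ValidRotor (LollipopAdj m) K R →
                (s : Fin (m + m)) → EdgesCoveredBy (LollipopAdj m) R s (C * (m + m) ^ 3))
theorem3p18 K = 12 * suc K , covered
  where
    covered : (m : ℕ) (R : Rotor (m + m)) → ValidRotor (LollipopAdj m) K R →
              (s : Fin (m + m)) → EdgesCoveredBy (LollipopAdj m) R s (12 * suc K * (m + m) ^ 3)
    covered zero     R valid ()
    covered (suc m′) R valid s = OnWalk.edges-covered R valid s _ bound<cubic
      where open Lollipop m′ K
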